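{- Let $G$ be a finite simple graph with $n$ vertices and let $D$ be an orientation of $G$ with $F(D)=\mathrm{MOF}(G)$. If $H$ is an induced subgraph of $D$ (an induced subgraph of $G$ on a nonempty vertex set, with the orientation inherited from $D$), then \[ \mathrm{MOF}(G)\leq F(H)+n-|H|\leq \mathrm{MOF}(H)+n-|H|, \] where $|H|$ is the number of vertices of $H$ and $\mathrm{MOF}(H)$ refers to the underlying simple graph of $H$.
   Context: An orientation $D$ of a simple graph $G$ assigns to each edge exactly one direction; if $(u,v)$ is an arc, $v$ is an out-neighbor of $u$. Oriented $1$-forcing: starting from a nonempty set $S$ of colored vertices, repeatedly, any colored vertex with at most one non-colored out-neighbor forces that out-neighbor to become colored (all forcings in a step simultaneous), until no change occurs; $S$ is a forcing set if all vertices end up colored. $F(D)$ is the minimum size of a forcing set of the oriented graph $D$, and $\mathrm{MOF}(G)$ is the maximum of $F(D)$ over all orientations $D$ of $G$. -}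

module Defs where

open import Data.Nat using (ℕ; zero; suc; _≤_; _+_)
open import Data.Fin using (Fin; _≟_)
open import Data.Bool using (Bool; true; false; _∧_; _∨_; not; if_then_else_)
open import Data.List using (List; allFin; map)
open import Data.Nat.ListAction using (sum)
open import Data.Bool.ListAction using (any; all)
open import Data.Product using (Σ; ∃; _×_; _,_)
open import Data.Sum using (_⊎_)
open import Relation.Binary.PropositionalEquality using (_≡_)
open import Relation.Nullary.Decidable using (⌊_⌋)
open import Function.Definitions using (Injective)

record Graph (n : ℕ) : Set where
  field
    adj    : Fin n → Fin n → Bool
    sym    : ∀ u v → adj u v ≡ adj v u
    irrefl : ∀ u → adj u u ≡ false
open Graph public

-- A directed graph on Fin n: arc u v ≡ true means (u , v) is an arc.
Digraph : ℕ → Set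
Digraph n = Fin n → Fin n → Bool

IsOrientation : ∀ {n} → Graph n → Digraph n → Set
IsOrientation {n} G D =
  (∀ u v → adj G u v ≡ true →
     (D u v ≡ true × D v u ≡ false) ⊎ (D u v ≡ false × D v u ≡ true))
  × (∀ u v → adj G u v ≡ false → D u v ≡ false)

VSet : ℕ → Set
VSet n = Fin n → Bool

size : ∀ {n} → VSet n → ℕ
size {n} S = sum (map (λ i → if S i then 1 else 0) (allFin n))

Nonempty : ∀ {n} → VSet n → Set
Nonempty S = ∃ λ i → S i ≡ true

forces : ∀ {n} → Digraph n → VSet n → Fin n → Fin n → Bool
forces {n} D S u v =
  S u ∧ D u v ∧ not (S v)
  ∧ all (λ w → not (D u w) ∨ S w ∨ ⌊ w ≟ v ⌋) (allFin n)

step : ∀ {n} → Digraph n → VSet n → VSet n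
step {n} D S v = S v ∨ any (λ u → forces D S u v) (allFin n)

iterate : ∀ {A : Set} → (A → A) → A → ℕ → A
iterate f x zero    = x
iterate f x (suc k) = f (iterate f x k)

IsForcingSet : ∀ {n} → Digraph n → VSet n → Set
IsForcingSet {n} D S =
  Nonempty S × ∃ λ k → ∀ v → iterate (step D) S k v ≡ true

IsF : ∀ {n} → Digraph n → ℕ → Set
IsF {n} D f =
  (∃ λ (S : VSet n) → IsForcingSet D S × size S ≡ f)
  × (∀ (S : VSet n) → IsForcingSet D S → f ≤ size S)

IsMOF : ∀ {n} → Graph n → ℕ → Set
IsMOF {n} G m =
  (∃ λ (D : Digraph n) → IsOrientation G D × IsF D m)
  × (∀ (D : Digraph n) (f : ℕ) → IsOrientation G D → IsF D f → f ≤ m)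

inducedDigraph : ∀ {n k} → Digraph n → (Fin k → Fin n) → Digraph k
inducedDigraph D ι i j = D (ι i) (ι j)

inducedGraph : ∀ {n k} (G : Graph n) (ι : Fin k → Fin n) → Injective _≡_ _≡_ ι → Graph k
inducedGraph G ι inj = record
  { adj    = λ i j → adj G (ι i) (ι j)
  ; sym    = λ i j → sym G (ι i) (ι j)
  ; irrefl = λ i → irrefl G (ι i)
  }

-- Extend a minimum forcing set X of the induced subdigraph H by coloring every
-- vertex outside H.  Each forcing step of H is still available in D, because the
-- out-neighbours of a forcing vertex that lie outside H are already colored, and
-- coloring more vertices never blocks a force; so the extension forces D and
-- F(D) ≤ |X| + (n − |H|).  The second inequality holds
-- because H is itself an orientation of its underlying graph.
module Submission where

open import Defs hiding (sym)
open import Data.Nat using (ℕ; _≤_; _+_; _∸_; _≥_; zero; suc; z≤n; s≤s)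
open import Data.Nat.Properties
  using (≤-trans; +-suc; +-assoc; +-comm; +-monoʳ-≤; +-monoˡ-≤; +-cancelʳ-≤; m≤n+m∸n; module ≤-Reasoning)
open import Data.Nat.ListAction using (sum)
open import Data.Fin using (Fin; _≟_) renaming (zero to fzero; suc to fsuc)
open import Data.Fin.Properties using (any?; suc-injective; 0≢1+n)
open import Data.Bool using (Bool; true; false; _∧_; _∨_; not; if_then_else_)
open import Data.Bool.Properties using (T-≡; ∨-zeroʳ; ∧-identityʳ; ¬-not) renaming (_≟_ to _≟ᵇ_)
open import Data.Bool.ListAction using (any; all)
open import Data.List using (allFin)
open import Data.List.Properties using (map-tabulate; map-cong)
open import Data.List.Membership.Propositional.Properties using (∈-allFin)
open import Data.List.Relation.Unary.Any as Any using (satisfied)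
open import Data.List.Relation.Unary.Any.Properties using (any⁺; any⁻)
open import Data.List.Relation.Unary.All as All using ()
open import Data.List.Relation.Unary.All.Properties using (all⁺; all⁻)
open import Data.Product using (∃; _×_; _,_; proj₂)
open import Data.Sum using (_⊎_; inj₁; inj₂)
open import Data.Empty using (⊥-elim)
open import Function using (_∘_; id)
open import Function.Bundles using (Equivalence)
open import Function.Definitions using (Injective)
open import Relation.Nullary using (yes; no; does)
open import Relation.Nullary.Decidable using (⌊_⌋; dec-false)
open import Relation.Binary.PropositionalEquality using (_≡_; refl; sym; trans; cong; subst)

open Equivalence using (to; from)

any-allFin⁻ : ∀ {n} (p : Fin n → Bool) → any p (allFin n) ≡ true → ∃ λ i → p i ≡ true
any-allFin⁻ p h =
  let i , pi = satisfied (any⁻ p (allFin _) (from T-≡ h)) in i , to T-≡ pi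

any-allFin⁺ : ∀ {n} (p : Fin n → Bool) i → p i ≡ true → any p (allFin n) ≡ true
any-allFin⁺ p i pi = to T-≡ (any⁺ {xs = allFin _} p (Any.map (λ { refl → from T-≡ pi }) (∈-allFin i)))

all-allFin⁻ : ∀ {n} (p : Fin n → Bool) → all p (allFin n) ≡ true → ∀ i → p i ≡ true
all-allFin⁻ p h i = to T-≡ (All.lookup (all⁺ p _ (from T-≡ h)) (∈-allFin i))

all-allFin⁺ : ∀ {n} (p : Fin n → Bool) → (∀ i → p i ≡ true) → all p (allFin n) ≡ true
all-allFin⁺ p h = to T-≡ (all⁻ p {xs = allFin _} (All.tabulate (λ {i} _ → from T-≡ (h i))))

∨≡true⁻ : ∀ a {b} → a ∨ b ≡ true → a ≡ true ⊎ b ≡ true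
∨≡true⁻ true  _ = inj₁ refl
∨≡true⁻ false h = inj₂ h

infix 4 _⊆_
_⊆_ : ∀ {n} → VSet n → VSet n → Set
S ⊆ S′ = ∀ v → S v ≡ true → S′ v ≡ true

⊆-false : ∀ {n} {S S′ : VSet n} → S ⊆ S′ → ∀ v → S′ v ≡ false → S v ≡ false
⊆-false {S = S} S⊆S′ v S′v≡false with S v in Sv
... | false = refl
... | true  with () ← trans (sym (S⊆S′ v Sv)) S′v≡false

record Forces {n} (D : Digraph n) (S : VSet n) (u v : Fin n) : Set where
  field
    colored   : S u ≡ true
    arc       : D u v ≡ true
    uncolored : S v ≡ false
    unique    : ∀ w → D u w ≡ true → S w ≡ false → w ≡ v

module _ {n} {D : Digraph n} {S : VSet n} {u v : Fin n} where

  forces⇒Forces : forces D S u v ≡ true → Forces D S u v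
  forces⇒Forces h with S u in Su | D u v in Duv | S v in Sv
  ... | true | true | false = record
    { colored = Su ; arc = Duv ; uncolored = Sv ; unique = unique }
    where
    unique : ∀ w → D u w ≡ true → S w ≡ false → w ≡ v
    unique w Duw Sw with w ≟ v | all-allFin⁻ _ h w
    ... | yes w≡v | _ = w≡v
    ... | no  _   | h′ rewrite Duw | Sw with () ← h′

  Forces⇒forces : Forces D S u v → forces D S u v ≡ true
  Forces⇒forces f rewrite Forces.colored f | Forces.arc f | Forces.uncolored f =
    all-allFin⁺ _ otherColored
    where
    open Forces f
    otherColored : ∀ w → (not (D u w) ∨ S w ∨ ⌊ w ≟ v ⌋) ≡ true
    otherColored w with D u w in Duw | S w in Sw
    ... | false | _     = refl
    ... | true  | true  = refl
    ... | true  | false with w ≟ v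
    ...   | yes _   = refl
    ...   | no  w≢v = ⊥-elim (w≢v (unique w Duw Sw))

step-inv : ∀ {n} (D : Digraph n) (S : VSet n) v →
  step D S v ≡ true → S v ≡ true ⊎ ∃ λ u → Forces D S u v
step-inv D S v h with ∨≡true⁻ (S v) h
... | inj₁ Sv     = inj₁ Sv
... | inj₂ forced = inj₂ (let u , f = any-allFin⁻ _ forced in u , forces⇒Forces f)

step-extensive : ∀ {n} (D : Digraph n) (S : VSet n) → S ⊆ step D S
step-extensive D S v Sv rewrite Sv = refl

step-forced : ∀ {n} {D : Digraph n} {S : VSet n} {u v} → Forces D S u v → step D S v ≡ true
step-forced {S = S} {u} {v} f =
  trans (cong (S v ∨_) (any-allFin⁺ _ u (Forces⇒forces f))) (∨-zeroʳ (S v))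

Forces-mono : ∀ {n} {D : Digraph n} {S S′ : VSet n} {u v} →
  S ⊆ S′ → S′ v ≡ false → Forces D S u v → Forces D S′ u v
Forces-mono S⊆S′ S′v f = record
  { colored   = S⊆S′ _ colored
  ; arc       = arc
  ; uncolored = S′v
  ; unique    = λ w Duw S′w → unique w Duw (⊆-false S⊆S′ w S′w)
  }
  where open Forces f

step-mono : ∀ {n} (D : Digraph n) {S S′ : VSet n} → S ⊆ S′ → step D S ⊆ step D S′
step-mono D {S} {S′} S⊆S′ v h with step-inv D S v h | S′ v ≟ᵇ true
... | _            | yes S′v = step-extensive D S′ v S′v
... | inj₁ Sv      | no  S′v = ⊥-elim (S′v (S⊆S′ v Sv))
... | inj₂ (u , f) | no  S′v = step-forced (Forces-mono S⊆S′ (¬-not S′v) f)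

indicator : Bool → ℕ
indicator b = if b then 1 else 0

size-suc : ∀ {n} (S : VSet (suc n)) → size S ≡ indicator (S fzero) + size (S ∘ fsuc)
size-suc S = cong (indicator (S fzero) +_) (cong sum
  (trans (map-tabulate fsuc (indicator ∘ S)) (sym (map-tabulate id (indicator ∘ S ∘ fsuc)))))

size-cong : ∀ {n} {S S′ : VSet n} → (∀ v → S v ≡ S′ v) → size S ≡ size S′
size-cong {n} S≗S′ = cong sum (map-cong (cong indicator ∘ S≗S′) (allFin n))

size-complement : ∀ {n} (S : VSet n) → size S + size (not ∘ S) ≡ n
size-complement {zero}  S = refl
size-complement {suc n} S
  rewrite size-suc S | size-suc (not ∘ S) with S fzero
... | true  = cong suc (size-complement (S ∘ fsuc))
... | false = trans (+-suc _ _) (cong suc (size-complement (S ∘ fsuc)))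

-- `does` rather than ⌊_⌋, so that `does (fsuc v ≟ fsuc x)` computes to `does (v ≟ x)`.
remove : ∀ {n} → VSet n → Fin n → VSet n
remove S x v = S v ∧ not (does (v ≟ x))

size-remove : ∀ {n} (S : VSet n) x → S x ≡ true → size S ≡ suc (size (remove S x))
size-remove {suc n} S fzero Sx rewrite size-suc S | size-suc (remove S fzero) | Sx =
  cong suc (size-cong (λ v → sym (∧-identityʳ (S (fsuc v)))))
size-remove {suc n} S (fsuc x) Sx rewrite size-suc S | size-suc (remove S (fsuc x)) | ∧-identityʳ (S fzero) =
  trans (cong (indicator (S fzero) +_) (size-remove (S ∘ fsuc) x Sx)) (+-suc _ _)

size-≤-injective : ∀ {k n} (ι : Fin k → Fin n) → Injective _≡_ _≡_ ι →
  (Y : VSet k) (P : VSet n) → (∀ i → Y i ≡ true → P (ι i) ≡ true) → size Y ≤ size P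
size-≤-injective {zero}  ι ι-inj Y P Y⊆P = z≤n
size-≤-injective {suc k} ι ι-inj Y P Y⊆P rewrite size-suc Y with Y fzero in Y₀
... | false = size-≤-injective (ι ∘ fsuc) (suc-injective ∘ ι-inj) (Y ∘ fsuc) P (Y⊆P ∘ fsuc)
... | true  = subst (suc (size (Y ∘ fsuc)) ≤_) (sym (size-remove P (ι fzero) (Y⊆P fzero Y₀)))
  (s≤s (size-≤-injective (ι ∘ fsuc) (suc-injective ∘ ι-inj) (Y ∘ fsuc) (remove P (ι fzero)) Y⊆P′))
  where
  Y⊆P′ : ∀ i → Y (fsuc i) ≡ true → remove P (ι fzero) (ι (fsuc i)) ≡ true
  Y⊆P′ i Yi rewrite dec-false (ι (fsuc i) ≟ ι fzero) (λ e → 0≢1+n (sym (ι-inj e))) =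
    trans (∧-identityʳ _) (Y⊆P (fsuc i) Yi)

≤+∸-of-complements : ∀ {a b c d n k} → a + b ≡ n → c + d ≡ k → d ≤ b → a ≤ c + (n ∸ k)
≤+∸-of-complements {a} {b} {c} {d} {n} {k} refl refl d≤b = +-cancelʳ-≤ b a (c + (n ∸ k)) (begin
  a + b                ≤⟨ m≤n+m∸n (a + b) (c + d) ⟩
  c + d + (n ∸ k)      ≡⟨ +-assoc c d (n ∸ k) ⟩
  c + (d + (n ∸ k))    ≡⟨ cong (c +_) (+-comm d (n ∸ k)) ⟩
  c + ((n ∸ k) + d)    ≤⟨ +-monoʳ-≤ c (+-monoʳ-≤ (n ∸ k) d≤b) ⟩
  c + ((n ∸ k) + b)    ≡⟨ sym (+-assoc c (n ∸ k) b) ⟩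
  c + (n ∸ k) + b      ∎)
  where open ≤-Reasoning

module Extension {k n} (ι : Fin k → Fin n) (ι-injective : Injective _≡_ _≡_ ι) where

  extend : VSet k → VSet n
  extend X v with any? (λ i → ι i ≟ v)
  ... | yes (i , _) = X i
  ... | no  _       = true

  extend-ι : ∀ X i → extend X (ι i) ≡ X i
  extend-ι X i with any? (λ j → ι j ≟ ι i)
  ... | yes (j , ιj≡ιi) = cong X (ι-injective ιj≡ιi)
  ... | no  ∉image      = ⊥-elim (∉image (i , refl))

  extend-view : ∀ v → (∃ λ i → ι i ≡ v) ⊎ (∀ X → extend X v ≡ true)
  extend-view v with any? (λ i → ι i ≟ v)
  ... | yes ∈image = inj₁ ∈image
  ... | no  _      = inj₂ (λ X → refl)

  extend-full : ∀ {X} → (∀ i → X i ≡ true) → ∀ v → extend X v ≡ true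
  extend-full {X} full v with extend-view v
  ... | inj₁ (i , refl) = trans (extend-ι X i) (full i)
  ... | inj₂ outside    = outside X

  module _ (D : Digraph n) where

    private
      H : Digraph k
      H = inducedDigraph D ι

    Forces-extend : ∀ {X u i} → Forces H X u i → Forces D (extend X) (ι u) (ι i)
    Forces-extend {X} {u} {i} f = record
      { colored   = trans (extend-ι X u) colored
      ; arc       = arc
      ; uncolored = trans (extend-ι X i) uncolored
      ; unique    = unique′
      }
      where
      open Forces f
      unique′ : ∀ w → D (ι u) w ≡ true → extend X w ≡ false → w ≡ ι i
      unique′ w Duw Xw with extend-view w
      ... | inj₁ (j , refl) = cong ι (unique j Duw (trans (sym (extend-ι X j)) Xw))
      ... | inj₂ outside    with () ← trans (sym (outside X)) Xw

    extend-step : ∀ X → extend (step H X) ⊆ step D (extend X)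
    extend-step X v h with extend-view v
    ... | inj₂ outside    = step-extensive D (extend X) v (outside X)
    ... | inj₁ (i , refl) with step-inv H X i (trans (sym (extend-ι (step H X) i)) h)
    ...   | inj₁ Xi       = step-extensive D (extend X) (ι i) (trans (extend-ι X i) Xi)
    ...   | inj₂ (u , f)  = step-forced (Forces-extend f)

    extend-iterate : ∀ X t → extend (iterate (step H) X t) ⊆ iterate (step D) (extend X) t
    extend-iterate X zero    v h = h
    extend-iterate X (suc t) v h =
      step-mono D (extend-iterate X t) v (extend-step (iterate (step H) X t) v h)

    extend-isForcingSet : ∀ {X} → IsForcingSet H X → IsForcingSet D (extend X)
    extend-isForcingSet {X} ((i , Xi) , t , full) =
      (ι i , trans (extend-ι X i) Xi) , t , λ v → extend-iterate X t v (extend-full full v)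

  size-extend : ∀ X → size (extend X) ≤ size X + (n ∸ k)
  size-extend X = ≤+∸-of-complements (size-complement (extend X)) (size-complement X)
    (size-≤-injective ι ι-injective (not ∘ X) (not ∘ extend X)
      (λ i Xi → trans (cong not (extend-ι X i)) Xi))

F≤F-induced+∸ : ∀ {n k} (D : Digraph n) (ι : Fin k → Fin n) → Injective _≡_ _≡_ ι →
  ∀ {f fH} → IsF D f → IsF (inducedDigraph D ι) fH → f ≤ fH + (n ∸ k)
F≤F-induced+∸ D ι ι-injective isF ((X , X-forces , refl) , _) =
  ≤-trans (proj₂ isF (extend X) (extend-isForcingSet D X-forces)) (size-extend X)
  where open Extension ι ι-injective

inducedDigraph-isOrientation : ∀ {n k} (G : Graph n) {D : Digraph n}
  (ι : Fin k → Fin n) (ι-injective : Injective _≡_ _≡_ ι) →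
  IsOrientation G D → IsOrientation (inducedGraph G ι ι-injective) (inducedDigraph D ι)
inducedDigraph-isOrientation G ι _ (oriented , noArc) =
  (λ i j → oriented (ι i) (ι j)) , (λ i j → noArc (ι i) (ι j))

theorem3p19 : ∀ (n : ℕ) (G : Graph n) (D : Digraph n) (mof fD : ℕ) →
    IsOrientation G D → IsMOF G mof → IsF D fD → fD ≡ mof →
    ∀ (k : ℕ) (ι : Fin k → Fin n) (inj : Injective _≡_ _≡_ ι) → k ≥ 1 →
    ∀ (fH mofH : ℕ) → IsF (inducedDigraph D ι) fH → IsMOF (inducedGraph G ι inj) mofH →
    (mof ≤ fH + (n ∸ k)) × (fH + (n ∸ k) ≤ mofH + (n ∸ k))
theorem3p19 n G D mof .mof D-orients _ isF refl k ι inj _ fH mofH isFH isMOFH =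
  F≤F-induced+∸ D ι inj isF isFH ,
  +-monoˡ-≤ (n ∸ k) (proj₂ isMOFH (inducedDigraph D ι) fH H-orients isFH)
  where
  H-orients : IsOrientation (inducedGraph G ι inj) (inducedDigraph D ι)
  H-orients = inducedDigraph-isOrientation G ι inj D-orients
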